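{- Let $M=(X,\mathcal{I})$ be a matroid of rank $r$ and let $B_1,\ldots,B_m\subseteq X$ be pairwise disjoint sets with each $B_i\in\mathcal{I}$. Then there exist $h=m+r$ sets $R_1,\ldots,R_h\in\mathcal{I}$ such that $|B_i\cap R_j|\le 1$ for all $i\in[m]$, $j\in[h]$, and $\bigcup_{j=1}^h R_j=\bigcup_{i=1}^m B_i$.
   Context: The elements of $B_i$ are thought of as having color $i$; the sets $R_j$ are then "rainbow" independent sets (no two elements of the same color) that together cover all the input elements. -}

module Defs where

open import Level using (0ℓ)
open import Data.Nat using (ℕ; _<_; _≤_)
open import Data.Fin using (Fin)
open import Data.Fin.Subset using (Subset; ⊥; _∈_; _∉_; _⊆_; _∪_; ⁅_⁆; ∣_∣)
open import Data.Product using (Σ; ∃; _×_)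
open import Relation.Nullary using (Dec)
open import Relation.Unary using (Pred)
open import Relation.Binary.PropositionalEquality using (_≡_)

-- Independence is required to be
-- decidable, which is automatic classically for a finite family.
record Matroid (n : ℕ) : Set₁ where
  field
    Indep     : Pred (Subset n) 0ℓ
    indep?    : (I : Subset n) → Dec (Indep I)
    indep-∅   : Indep ⊥
    indep-⊆   : ∀ {I J : Subset n} → J ⊆ I → Indep I → Indep J
    augment   : ∀ {I J : Subset n} → Indep I → Indep J → ∣ I ∣ < ∣ J ∣ →
                Σ (Fin n) (λ x → x ∈ J × x ∉ I × Indep (I ∪ ⁅ x ⁆))

HasRank : ∀ {n} → Matroid n → ℕ → Set
HasRank M r =
  ∃ (λ I → Indep I × ∣ I ∣ ≡ r) × (∀ I → Indep I → ∣ I ∣ ≤ r)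
  where open Matroid M

{-# OPTIONS --safe #-}
module Submission where

-- Induction on m, maintaining m + r rainbow independent sets R₀, …, R_{m+r-1} that
-- cover the colour classes and satisfy ∣ Rⱼ ∣ ≤ j + 1.  To add a new colour class S
-- (∣ S ∣ ≤ r), prepend the empty set, so that the set in position j has at most j
-- elements, and distribute S from the top down: while k elements of S remain, the set
-- in position k − 1 is smaller than what is left of S, so the augmentation axiom moves
-- one of them into it.  Every set receives at most one element of S, so it stays
-- rainbow and grows by at most one, which restores the size bound.

open import Defs
open import Level using (Level)
open import Data.Nat using (ℕ; zero; suc; _+_; _≤_; _<_; z≤n; s≤s)
open import Data.Nat.Properties
  using (≤-trans; ≤-reflexive; ≤-antisym; n≤1+n; n<1+n; m≤n⇒m≤1+n; m≤n+m; <⇒≤; ≤⇒≯; n≮0;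
         +-comm; +-suc; +-monoʳ-≤; suc-injective; module ≤-Reasoning)
open import Data.Fin using (Fin; zero; suc; toℕ; fromℕ<; _≟_)
open import Data.Fin.Properties using (toℕ-fromℕ<) renaming (suc-injective to Fin-suc-injective)
open import Data.Fin.Subset
  using (Subset; inside; outside; ⊥; ⁅_⁆; _∈_; _⊆_; _∩_; _∪_; _-_; ∣_∣; Empty)
open import Data.Fin.Subset.Properties
  using (∉⊥; ∣⊥∣≡0; x∈⁅x⁆; x∈⁅y⁆⇒x≡y; ∣⁅x⁆∣≡1; ⊆-refl; p⊆q⇒∣p∣≤∣q∣; x∈p∩q⁺; x∈p∩q⁻;
         ∣p∩q∣≤∣q∣; p⊆p∪q; q⊆p∪q; x∈p∪q⁺; x∈p∪q⁻; p─q⊆p; x∈p∧x≢y⇒x∈p-y; x∈p⇒∣p-x∣<∣p∣;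
         Empty-unique)
open import Data.Vec.Functional using (Vector; _∷_; tail; updateAt)
open import Data.Vec.Functional.Properties using (updateAt-updates; updateAt-minimal)
open import Data.Product using (Σ; ∃; _×_; _,_; uncurry)
open import Data.Sum using (inj₁; inj₂)
open import Function using (_∘_)
open import Function.Bundles using (_⇔_; mk⇔)
open import Relation.Nullary using (yes; no; contradiction)
open import Relation.Binary.PropositionalEquality using (_≡_; _≢_; refl; sym; trans; cong; subst)

private
  variable
    a ℓ : Level
    n : ℕ
    A A′ B S T : Subset n

module _ where
  open import Data.Vec using ([]; _∷_)

  ∣p∪q∣≤∣p∣+∣q∣ : (p q : Subset n) → ∣ p ∪ q ∣ ≤ ∣ p ∣ + ∣ q ∣
  ∣p∪q∣≤∣p∣+∣q∣ []            []            = z≤n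
  ∣p∪q∣≤∣p∣+∣q∣ (inside  ∷ p) (inside  ∷ q) =
    s≤s (≤-trans (∣p∪q∣≤∣p∣+∣q∣ p q) (+-monoʳ-≤ ∣ p ∣ (n≤1+n ∣ q ∣)))
  ∣p∪q∣≤∣p∣+∣q∣ (inside  ∷ p) (outside ∷ q) = s≤s (∣p∪q∣≤∣p∣+∣q∣ p q)
  ∣p∪q∣≤∣p∣+∣q∣ (outside ∷ p) (inside  ∷ q) =
    ≤-trans (s≤s (∣p∪q∣≤∣p∣+∣q∣ p q)) (≤-reflexive (sym (+-suc ∣ p ∣ ∣ q ∣)))
  ∣p∪q∣≤∣p∣+∣q∣ (outside ∷ p) (outside ∷ q) = ∣p∪q∣≤∣p∣+∣q∣ p q

∣p∪⁅x⁆∣≤1+∣p∣ : (p : Subset n) (x : Fin n) → ∣ p ∪ ⁅ x ⁆ ∣ ≤ suc ∣ p ∣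
∣p∪⁅x⁆∣≤1+∣p∣ p x = begin
  ∣ p ∪ ⁅ x ⁆ ∣      ≤⟨ ∣p∪q∣≤∣p∣+∣q∣ p ⁅ x ⁆ ⟩
  ∣ p ∣ + ∣ ⁅ x ⁆ ∣  ≡⟨ cong (∣ p ∣ +_) (∣⁅x⁆∣≡1 x) ⟩
  ∣ p ∣ + 1          ≡⟨ +-comm ∣ p ∣ 1 ⟩
  suc ∣ p ∣          ∎
  where open ≤-Reasoning

p⊆p-x∪⁅x⁆ : (p : Subset n) (x : Fin n) → p ⊆ (p - x) ∪ ⁅ x ⁆
p⊆p-x∪⁅x⁆ p x {y} y∈p with y ≟ x
... | yes refl = x∈p∪q⁺ (inj₂ (x∈⁅x⁆ x))
... | no  y≢x  = x∈p∪q⁺ (inj₁ (x∈p∧x≢y⇒x∈p-y y∈p y≢x))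

x∈p⇒∣p∣≡1+∣p-x∣ : {p : Subset n} {x : Fin n} → x ∈ p → ∣ p ∣ ≡ suc ∣ p - x ∣
x∈p⇒∣p∣≡1+∣p-x∣ {p = p} {x} x∈p = ≤-antisym
  (≤-trans (p⊆q⇒∣p∣≤∣q∣ (p⊆p-x∪⁅x⁆ p x)) (∣p∪⁅x⁆∣≤1+∣p∣ (p - x) x))
  (x∈p⇒∣p-x∣<∣p∣ x∈p)

updateAt-elim : ∀ {A : Set a} {N} (P : Fin N → A → Set ℓ) (xs : Vector A N) (i : Fin N)
                {f : A → A} → P i (f (xs i)) → (∀ j → j ≢ i → P j (xs j)) →
                ∀ j → P j (updateAt xs i f j)
updateAt-elim P xs i Pi Pj j with j ≟ i
... | yes refl = subst (P i) (sym (updateAt-updates i xs)) Pi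
... | no  j≢i  = subst (P j) (sym (updateAt-minimal j i xs j≢i)) (Pj j j≢i)

data AddsAtMostOne (S A : Subset n) : Subset n → Set where
  none : AddsAtMostOne S A A
  one  : ∀ {x} → x ∈ S → AddsAtMostOne S A (A ∪ ⁅ x ⁆)

addsAtMostOne-⊆ : AddsAtMostOne S A A′ → A ⊆ A′
addsAtMostOne-⊆ none    = ⊆-refl
addsAtMostOne-⊆ (one _) = p⊆p∪q _

addsAtMostOne-⊆∪ : AddsAtMostOne S A A′ → A′ ⊆ A ∪ S
addsAtMostOne-⊆∪ none = p⊆p∪q _
addsAtMostOne-⊆∪ {S = S} {A = A} (one {x} x∈S) y∈A∪x with x∈p∪q⁻ A ⁅ x ⁆ y∈A∪x
... | inj₁ y∈A = p⊆p∪q S y∈A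
... | inj₂ y∈x = q⊆p∪q A S (subst (_∈ S) (sym (x∈⁅y⁆⇒x≡y x y∈x)) x∈S)

addsAtMostOne-mono : S ⊆ T → AddsAtMostOne S A A′ → AddsAtMostOne T A A′
addsAtMostOne-mono _   none      = none
addsAtMostOne-mono S⊆T (one x∈S) = one (S⊆T x∈S)

∣addsAtMostOne∣ : AddsAtMostOne S A A′ → ∣ A′ ∣ ≤ suc ∣ A ∣
∣addsAtMostOne∣ {A = A} none        = n≤1+n ∣ A ∣
∣addsAtMostOne∣ {A = A} (one {x} _) = ∣p∪⁅x⁆∣≤1+∣p∣ A x

∣∩-addsAtMostOne∣ : (B : Subset n) → AddsAtMostOne S A A′ → ∣ B ∩ A′ ∣ ≤ suc ∣ B ∩ A ∣
∣∩-addsAtMostOne∣ {A = A} B none        = n≤1+n ∣ B ∩ A ∣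
∣∩-addsAtMostOne∣ {A = A} B (one {x} _) =
  ≤-trans (p⊆q⇒∣p∣≤∣q∣ B∩[A∪x]⊆[B∩A]∪x) (∣p∪⁅x⁆∣≤1+∣p∣ (B ∩ A) x)
  where
  B∩[A∪x]⊆[B∩A]∪x : B ∩ (A ∪ ⁅ x ⁆) ⊆ (B ∩ A) ∪ ⁅ x ⁆
  B∩[A∪x]⊆[B∩A]∪x y∈ with x∈p∩q⁻ B (A ∪ ⁅ x ⁆) y∈
  ... | y∈B , y∈A∪x with x∈p∪q⁻ A ⁅ x ⁆ y∈A∪x
  ...   | inj₁ y∈A = x∈p∪q⁺ (inj₁ (x∈p∩q⁺ (y∈B , y∈A)))
  ...   | inj₂ y∈x = x∈p∪q⁺ (inj₂ y∈x)

∩-addsAtMostOne-disjoint : Empty (B ∩ S) → AddsAtMostOne S A A′ → B ∩ A′ ⊆ B ∩ A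
∩-addsAtMostOne-disjoint {B = B} {S = S} {A = A} {A′ = A′} B∩S-empty adds {y} y∈
  with x∈p∩q⁻ B A′ y∈
... | y∈B , y∈A′ with x∈p∪q⁻ A S (addsAtMostOne-⊆∪ adds y∈A′)
...   | inj₁ y∈A = x∈p∩q⁺ (y∈B , y∈A)
...   | inj₂ y∈S = contradiction (y , x∈p∩q⁺ (y∈B , y∈S)) B∩S-empty

module _ (M : Matroid n) where
  open Matroid M

  record Spread {N} (S : Subset n) (L L′ : Fin N → Subset n) : Set where
    field
      indep     : ∀ t → Indep (L′ t)
      adds      : ∀ t → AddsAtMostOne S (L t) (L′ t)
      unchanged : ∀ t → ∣ S ∣ ≤ toℕ t → L′ t ≡ L t
      covers    : ∀ {y} → y ∈ S → ∃ λ t → y ∈ L′ t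

  spread-step : ∀ {N} {S : Subset n} {x} {L L″ : Fin N → Subset n} (p : Fin N) →
                toℕ p ≡ ∣ S - x ∣ → x ∈ S → Indep (L p ∪ ⁅ x ⁆) →
                Spread (S - x) L L″ → Spread S L (updateAt L″ p (_∪ ⁅ x ⁆))
  spread-step {S = S} {x} {L} {L″} p toℕp≡∣S-x∣ x∈S indLp∪x spread″ = record
    { indep     = updateAt-elim (λ _ → Indep) L″ p
                    (subst (λ A → Indep (A ∪ ⁅ x ⁆)) (sym L″p≡Lp) indLp∪x)
                    (λ t _ → indep t)
    ; adds      = updateAt-elim (λ t → AddsAtMostOne S (L t)) L″ p
                    (subst (λ A → AddsAtMostOne S (L p) (A ∪ ⁅ x ⁆)) (sym L″p≡Lp) (one x∈S))
                    (λ t _ → addsAtMostOne-mono (p─q⊆p S ⁅ x ⁆) (adds t))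
    ; unchanged = updateAt-elim (λ t A → ∣ S ∣ ≤ toℕ t → A ≡ L t) L″ p
                    (λ ∣S∣≤p → contradiction ∣S-x∣<∣S∣ (≤⇒≯ (subst (∣ S ∣ ≤_) toℕp≡∣S-x∣ ∣S∣≤p)))
                    (λ t _ ∣S∣≤t → unchanged t (≤-trans (<⇒≤ ∣S-x∣<∣S∣) ∣S∣≤t))
    ; covers    = covers′
    }
    where
    open Spread spread″
    ∣S-x∣<∣S∣ : ∣ S - x ∣ < ∣ S ∣
    ∣S-x∣<∣S∣ = x∈p⇒∣p-x∣<∣p∣ x∈S
    L″p≡Lp : L″ p ≡ L p
    L″p≡Lp = unchanged p (≤-reflexive (sym toℕp≡∣S-x∣))
    covers′ : ∀ {y} → y ∈ S → ∃ λ t → y ∈ updateAt L″ p (_∪ ⁅ x ⁆) t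
    covers′ {y} y∈S with y ≟ x
    ... | yes refl = p , subst (y ∈_) (sym (updateAt-updates p L″)) (q⊆p∪q (L″ p) ⁅ y ⁆ (x∈⁅x⁆ y))
    ... | no  y≢x  =
      let t , y∈L″t = covers (x∈p∧x≢y⇒x∈p-y y∈S y≢x)
      in t , updateAt-elim (λ t A → L″ t ⊆ A) L″ p (p⊆p∪q ⁅ x ⁆) (λ _ _ → ⊆-refl) t y∈L″t

  spread : ∀ {N} s {S : Subset n} (L : Fin N → Subset n) → ∣ S ∣ ≡ s → s ≤ N → Indep S →
           (∀ t → Indep (L t)) → (∀ t → ∣ L t ∣ ≤ toℕ t) → ∃ (Spread S L)
  spread zero {S} L ∣S∣≡0 _ _ indL _ = L , record
    { indep     = indL
    ; adds      = λ _ → none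
    ; unchanged = λ _ _ → refl
    ; covers    = λ {y} y∈S → contradiction (subst (∣ S - y ∣ <_) ∣S∣≡0 (x∈p⇒∣p-x∣<∣p∣ y∈S)) n≮0
    }
  spread (suc s) {S} L ∣S∣≡1+s 1+s≤N indS indL ∣L∣≤ =
    let (x , x∈S , _ , indLp∪x) = augment (indL p) indS ∣Lp∣<∣S∣
        ∣S-x∣≡s = suc-injective (trans (sym (x∈p⇒∣p∣≡1+∣p-x∣ x∈S)) ∣S∣≡1+s)
        (L″ , spread″) = spread s L ∣S-x∣≡s (<⇒≤ 1+s≤N) (indep-⊆ (p─q⊆p S ⁅ x ⁆) indS) indL ∣L∣≤
    in updateAt L″ p (_∪ ⁅ x ⁆) ,
       spread-step p (trans (toℕ-fromℕ< 1+s≤N) (sym ∣S-x∣≡s)) x∈S indLp∪x spread″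
    where
    p = fromℕ< 1+s≤N
    ∣Lp∣<∣S∣ : ∣ L p ∣ < ∣ S ∣
    ∣Lp∣<∣S∣ = begin-strict
      ∣ L p ∣  ≤⟨ ∣L∣≤ p ⟩
      toℕ p    ≡⟨ toℕ-fromℕ< 1+s≤N ⟩
      s        <⟨ n<1+n s ⟩
      suc s    ≡⟨ sym ∣S∣≡1+s ⟩
      ∣ S ∣    ∎
      where open ≤-Reasoning

  record IsRainbowCover {m N} (B : Fin m → Subset n) (R : Fin N → Subset n) : Set where
    field
      indep    : ∀ j → Indep (R j)
      rainbow  : ∀ i j → ∣ B i ∩ R j ∣ ≤ 1
      sound    : ∀ {x} j → x ∈ R j → ∃ λ i → x ∈ B i
      complete : ∀ {x} i → x ∈ B i → ∃ λ j → x ∈ R j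

  ⊥∷-isRainbowCover : ∀ {m N} {B : Fin m → Subset n} {R : Fin N → Subset n} →
                      IsRainbowCover B R → IsRainbowCover B (⊥ ∷ R)
  ⊥∷-isRainbowCover {B = B} cover = record
    { indep    = λ { zero → indep-∅ ; (suc j) → indep j }
    ; rainbow  = λ { i zero → ≤-trans (∣p∩q∣≤∣q∣ (B i) ⊥) (≤-trans (≤-reflexive (∣⊥∣≡0 n)) z≤n)
                   ; i (suc j) → rainbow i j }
    ; sound    = λ { zero x∈⊥ → contradiction x∈⊥ ∉⊥ ; (suc j) → sound j }
    ; complete = λ i x∈Bi → let j , x∈Rj = complete i x∈Bi in suc j , x∈Rj
    }
    where open IsRainbowCover cover

  spread-isRainbowCover : ∀ {m N} {B : Fin (suc m) → Subset n} {L L′ : Fin N → Subset n} →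
                          (∀ i i′ → i ≢ i′ → Empty (B i ∩ B i′)) →
                          IsRainbowCover (tail B) L → Spread (B zero) L L′ → IsRainbowCover B L′
  spread-isRainbowCover {B = B} {L} {L′} disjoint cover spread′ = record
    { indep    = Spread.indep spread′
    ; rainbow  = rainbow′
    ; sound    = sound′
    ; complete = complete′
    }
    where
    open IsRainbowCover cover
    open Spread spread′ using (adds; covers)

    B₀∩L-empty : ∀ t → Empty (B zero ∩ L t)
    B₀∩L-empty t (y , y∈B₀∩Lt) =
      let y∈B₀ , y∈Lt = x∈p∩q⁻ (B zero) (L t) y∈B₀∩Lt
          i , y∈Bi    = sound t y∈Lt
      in disjoint zero (suc i) (λ ()) (y , x∈p∩q⁺ (y∈B₀ , y∈Bi))

    rainbow′ : ∀ i t → ∣ B i ∩ L′ t ∣ ≤ 1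
    rainbow′ zero t = begin
      ∣ B zero ∩ L′ t ∣     ≤⟨ ∣∩-addsAtMostOne∣ (B zero) (adds t) ⟩
      suc ∣ B zero ∩ L t ∣  ≡⟨ cong (suc ∘ ∣_∣) (Empty-unique (B₀∩L-empty t)) ⟩
      suc ∣ ⊥ {n = n} ∣     ≡⟨ cong suc (∣⊥∣≡0 n) ⟩
      1                     ∎
      where open ≤-Reasoning
    rainbow′ (suc i) t = ≤-trans
      (p⊆q⇒∣p∣≤∣q∣ (∩-addsAtMostOne-disjoint (disjoint (suc i) zero (λ ())) (adds t)))
      (rainbow i t)

    sound′ : ∀ {y} t → y ∈ L′ t → ∃ λ i → y ∈ B i
    sound′ t y∈L′t with x∈p∪q⁻ (L t) (B zero) (addsAtMostOne-⊆∪ (adds t) y∈L′t)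
    ... | inj₁ y∈Lt = let i , y∈Bi = sound t y∈Lt in suc i , y∈Bi
    ... | inj₂ y∈B₀ = zero , y∈B₀

    complete′ : ∀ {y} i → y ∈ B i → ∃ λ t → y ∈ L′ t
    complete′ zero    y∈B₀ = covers y∈B₀
    complete′ (suc i) y∈Bi = let t , y∈Lt = complete i y∈Bi in t , addsAtMostOne-⊆ (adds t) y∈Lt

  rainbowCover : ∀ r m (B : Fin m → Subset n) → (∀ i i′ → i ≢ i′ → Empty (B i ∩ B i′)) →
                 (∀ i → Indep (B i)) → (∀ i → ∣ B i ∣ ≤ r) →
                 Σ (Fin (m + r) → Subset n) λ R →
                   IsRainbowCover B R × (∀ j → ∣ R j ∣ ≤ suc (toℕ j))
  rainbowCover r zero B _ _ _ = (λ _ → ⊥) , record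
    { indep    = λ _ → indep-∅
    ; rainbow  = λ ()
    ; sound    = λ _ x∈⊥ → contradiction x∈⊥ ∉⊥
    ; complete = λ ()
    } , λ _ → ≤-trans (≤-reflexive (∣⊥∣≡0 n)) z≤n
  rainbowCover r (suc m) B disjoint indB ∣B∣≤r =
    let (R , cover , ∣R∣≤) = rainbowCover r m (tail B)
                               (λ i i′ i≢i′ → disjoint (suc i) (suc i′) (i≢i′ ∘ Fin-suc-injective))
                               (indB ∘ suc) (∣B∣≤r ∘ suc)
        cover₀ = ⊥∷-isRainbowCover cover
        (R′ , spread′) = spread ∣ B zero ∣ (⊥ ∷ R) refl
                           (m≤n⇒m≤1+n (≤-trans (∣B∣≤r zero) (m≤n+m r m)))
                           (indB zero) (IsRainbowCover.indep cover₀) (∣⊥∷R∣≤ ∣R∣≤)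
    in R′ , spread-isRainbowCover disjoint cover₀ spread′ ,
       λ t → ≤-trans (∣addsAtMostOne∣ (Spread.adds spread′ t)) (s≤s (∣⊥∷R∣≤ ∣R∣≤ t))
    where
    ∣⊥∷R∣≤ : ∀ {N} {R : Fin N → Subset n} → (∀ j → ∣ R j ∣ ≤ suc (toℕ j)) →
             ∀ t → ∣ (⊥ ∷ R) t ∣ ≤ toℕ t
    ∣⊥∷R∣≤ _     zero    = ≤-reflexive (∣⊥∣≡0 n)
    ∣⊥∷R∣≤ ∣R∣≤ (suc j) = ∣R∣≤ j

corollary2p2 : ∀ {n : ℕ} (M : Matroid n) (r : ℕ) → HasRank M r →
    (m : ℕ) (B : Fin m → Subset n) →
    (∀ i i′ → i ≢ i′ → Empty (B i ∩ B i′)) →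
    (∀ i → Matroid.Indep M (B i)) →
    Σ (Fin (m + r) → Subset n) (λ R →
      (∀ j → Matroid.Indep M (R j)) ×
      (∀ i j → ∣ B i ∩ R j ∣ ≤ 1) ×
      (∀ x → (∃ (λ j → x ∈ R j)) ⇔ (∃ (λ i → x ∈ B i))))
corollary2p2 M r (_ , rank-bound) m B disjoint indB =
  let (R , cover , _) = rainbowCover M r m B disjoint indB (λ i → rank-bound (B i) (indB i))
      open IsRainbowCover cover
  in R , indep , rainbow , λ x → mk⇔ (uncurry sound) (uncurry complete)
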